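{- Let $m$ be a positive integer, and let $\mathcal{G}$ be a finite abelian group with at most $m$ invariant factors. There is an arithmetical structure on a broom graph with $m+1$ prongs whose critical group is isomorphic to $\mathcal{G}$.
   Context: A broom graph with $j$ prongs is a tree obtained from a path $c,u_1,\dots,u_p$ ($p\ge1$) by attaching $j$ new leaves (the prongs) to the endpoint $c$; equivalently, a starlike tree with $j+1$ tentacles of which at most one has more than one vertex. An arithmetical structure on a tree $T$ is a pair $(\mathbf{d},\mathbf{r})$ with $\mathbf{d}\in\mathbb{Z}_{\ge0}^{V(T)}$, $\mathbf{r}\in\mathbb{Z}_{>0}^{V(T)}$ whose entries have no nontrivial common factor, and $(\operatorname{diag}(\mathbf{d})-A(T))\mathbf{r}=\mathbf{0}$, where $A(T)$ is the adjacency matrix; its critical group is the torsion subgroup of $\mathbb{Z}^{V(T)}/\operatorname{im}(\operatorname{diag}(\mathbf{d})-A(T))$. The number of invariant factors of a finite abelian group is the number of nontrivial cyclic factors in its invariant factor decomposition. -}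

module Defs where

open import Level using (Level; _⊔_)
open import Data.Bool using (Bool; true; false; if_then_else_; _∧_; _∨_)
open import Data.Nat as ℕ using (ℕ; zero; suc; _≡ᵇ_; _≤ᵇ_; _<ᵇ_)
import Data.Nat.Divisibility as ℕD
open import Data.Integer as ℤ using (ℤ; +_; 0ℤ; 1ℤ)
open import Data.Integer.Divisibility using () renaming (_∣_ to _∣ℤ_)
open import Data.Fin using (Fin; zero; suc; toℕ)
open import Data.Product using (Σ; _×_; _,_; ∃)
open import Data.List using (List)
open import Data.List.Relation.Unary.Any using (Any)
open import Relation.Binary.PropositionalEquality using (_≡_)
open import Algebra.Bundles using (AbelianGroup)
open import Data.Unit using () renaming (⊤ to Unit)

Vecℤ : ℕ → Set
Vecℤ n = Fin n → ℤ

Matℤ : ℕ → Set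
Matℤ n = Fin n → Fin n → ℤ

sumFin : ∀ n → (Fin n → ℤ) → ℤ
sumFin zero    f = 0ℤ
sumFin (suc n) f = f zero ℤ.+ sumFin n (λ i → f (suc i))

_·_ : ∀ {n} → Matℤ n → Vecℤ n → Vecℤ n
_·_ {n} M x i = sumFin n (λ j → M i j ℤ.* x j)

_+ᵥ_ : ∀ {n} → Vecℤ n → Vecℤ n → Vecℤ n
(x +ᵥ y) i = x i ℤ.+ y i

_-ᵥ_ : ∀ {n} → Vecℤ n → Vecℤ n → Vecℤ n
(x -ᵥ y) i = x i ℤ.- y i

diagMinus : ∀ {n} → (Fin n → ℕ) → Matℤ n → Matℤ n
diagMinus d A i j =
  (if toℕ i ≡ᵇ toℕ j then + d i else 0ℤ) ℤ.- A i j

-- The broom graph with path c,u₁,…,u_p and j prongs.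
-- Vertex set Fin (suc (p + j)):  0 = c,  1..p = u₁..u_p,  p+1..p+j = prongs.

broomEdgeᵇ : ℕ → ℕ → ℕ → Bool
broomEdgeᵇ p a b = ((suc a ≡ᵇ b) ∧ (b ≤ᵇ p)) ∨ ((a ≡ᵇ 0) ∧ (p <ᵇ b))

broomAdj : (p j : ℕ) → Matℤ (suc (p ℕ.+ j))
broomAdj p j u v =
  if broomEdgeᵇ p (toℕ u) (toℕ v) ∨ broomEdgeᵇ p (toℕ v) (toℕ u)
  then 1ℤ else 0ℤ

record IsArithmeticalStructure {n : ℕ} (A : Matℤ n) (d r : Fin n → ℕ) : Set where
  field
    r-pos      : ∀ i → 0 ℕ.< r i
    r-primitive : ∀ k → (∀ i → k ℕD.∣ r i) → k ≡ 1
    kernel     : ∀ i → (diagMinus d A · (λ j → + r j)) i ≡ 0ℤ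

InImage : ∀ {n} → Matℤ n → Vecℤ n → Set
InImage M x = ∃ λ y → ∀ i → x i ≡ (M · y) i

IsTorsion : ∀ {n} → Matℤ n → Vecℤ n → Set
IsTorsion M x = Σ ℕ λ k → (0 ℕ.< k) × InImage M (λ i → + k ℤ.* x i)

-- Group isomorphism between an abelian group G and a subquotient Car / H
-- of ℤⁿ, where H ⊆ Car are subgroups of ℤⁿ given by predicates.
-- (Quotients are not types in Agda; the subquotient is represented by
--  elements satisfying Car, compared modulo H.)

record IsoToSubquotient {c ℓ} (G : AbelianGroup c ℓ) (n : ℕ)
         (Car : Vecℤ n → Set) (H : Vecℤ n → Set) : Set (c ⊔ ℓ) where
  open AbelianGroup G
  _≡H_ : Vecℤ n → Vecℤ n → Set
  x ≡H y = H (x -ᵥ y)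
  field
    φ            : Carrier → Vecℤ n
    φ-lands      : ∀ a → Car (φ a)
    φ-wellDef    : ∀ a b → a ≈ b → φ a ≡H φ b
    φ-injective  : ∀ a b → φ a ≡H φ b → a ≈ b
    φ-hom        : ∀ a b → φ (a ∙ b) ≡H (φ a +ᵥ φ b)
    φ-surjective : ∀ x → Car x → ∃ λ a → φ a ≡H x

IsoToCriticalGroup : ∀ {c ℓ} (G : AbelianGroup c ℓ) {n} (A : Matℤ n) (d : Fin n → ℕ) → Set (c ⊔ ℓ)
IsoToCriticalGroup G {n} A d =
  IsoToSubquotient G n (IsTorsion (diagMinus d A)) (InImage (diagMinus d A))

Finite : ∀ {c ℓ} → AbelianGroup c ℓ → Set (c ⊔ ℓ)
Finite G = Σ (List Carrier) λ xs → ∀ a → Any (a ≈_) xs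
  where open AbelianGroup G

-- G ≅ ℤ/d₁ ⊕ ⋯ ⊕ ℤ/d_k with 1 < dᵢ and d₁ ∣ d₂ ∣ ⋯ ∣ d_k
-- (invariant factor decomposition with exactly k invariant factors)
InvariantFactorDecomposition : ∀ {c ℓ} → AbelianGroup c ℓ → (k : ℕ) → (Fin k → ℕ) → Set (c ⊔ ℓ)
InvariantFactorDecomposition G k d =
  (∀ i → 1 ℕ.< d i) ×
  (∀ i j → toℕ i ℕ.≤ toℕ j → d i ℕD.∣ d j) ×
  IsoToSubquotient G k (λ _ → Unit) (λ x → ∀ i → (+ d i) ∣ℤ x i)

HasAtMostInvariantFactors : ∀ {c ℓ} → ℕ → AbelianGroup c ℓ → Set (c ⊔ ℓ)
HasAtMostInvariantFactors m G =
  Σ ℕ λ k → (k ℕ.≤ m) × Σ (Fin k → ℕ) λ d → InvariantFactorDecomposition G k d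

module Submission where

-- Pad the invariant factors with 1s to D 0, …, D (m − 1), so that G ≅ ⊕ ℤ / D i. Put P = ∏ D i,
-- N = P², R i = N / D i and K = 1 + ∑ R i. On the broom with centre u₀, path u₁ … u_p and prongs
-- v₀ … v_m, let (d, r) be (N, 1) on v₀ and (D i, R i) on v (i + 1), let r = N at the centre, and pick
-- 0 < y ≤ N with y ≡ −K (mod N), so that the centre balances with d = (K + y) / N there. As
-- gcd (N, y) = 1, the remainders N, y, …, 1 of the negative continued fraction of N / y give r along
-- the path, and its partial quotients give d. Then u ↦ (u i on v (i + 1), −∑ u i R i on v₀, 0 elsewhere)
-- induces ⊕ ℤ / D i ≅ torsion (ℤⁿ / im (diag d − A)): a torsion class is orthogonal to the kernel
-- vector r, and back substitution along the path moves it onto the prongs.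

open import Defs

open import Algebra.Bundles using (AbelianGroup)
open import Data.Bool using (Bool; true; false; if_then_else_; _∨_; T)
open import Data.Bool.Properties using (∨-comm)
open import Data.Empty using (⊥-elim)
open import Data.Fin using (Fin; zero; suc; toℕ; _↑ˡ_; _↑ʳ_; splitAt; join)
open import Data.Fin.Properties using (toℕ-injective; toℕ-↑ˡ; toℕ-↑ʳ; toℕ≤pred[n]; join-splitAt; _≟_)
open import Data.Integer using (ℤ; +_; 0ℤ; 1ℤ)
open import Data.Integer.Divisibility using () renaming (_∣_ to _∣ℤ_)
import Data.Integer.Divisibility.Signed as DS
import Data.Integer.Properties as ℤₚ
open import Algebra.Properties.Ring ℤₚ.+-*-ring using ([y-z]x≈yx-zx; x[y-z]≈xy-xz)
open import Data.Integer.Tactic.RingSolver using (solve-∀)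
open import Data.List using (tabulate)
open import Data.List.Membership.Propositional.Properties using (∈-tabulate⁺)
import Data.List.Relation.Unary.All.Properties as All
import Data.Nat as ℕ
open ℕ using (ℕ; zero; suc; _≡ᵇ_; _≤ᵇ_; _<ᵇ_; _≤_; _<_; z≤n; s≤s; pred)
open import Data.Nat.Coprimality using (Coprime; coprime-divisor)
open import Data.Nat.DivMod using (_/_; _%_; m≡m%n+[m/n]*n; m%n<n)
open import Data.Nat.Divisibility
  using (_∣_; 1∣_; ∣1⇒≡1; ∣-trans; ∣m⇒∣m*n; ∣-refl; ∣m+n∣m⇒∣n; ∣n⇒∣m*n; m%n≡0⇒n∣m)
open import Data.Nat.Induction using (<-rec)
open import Data.Nat.ListAction using (sum; product)
open import Data.Nat.ListAction.Properties using (product≢0; ∈⇒∣product)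
import Data.Nat.Properties as ℕₚ
open import Data.Product using (Σ; ∃; _×_; _,_; proj₁; proj₂)
open import Data.Sum using (inj₁; inj₂; [_,_]; [_,_]′)
open import Data.Unit using (⊤; tt)
open import Data.Vec.Functional using (_++_; zipWith; map)
open import Data.Vec.Functional.Properties using (lookup-++ˡ; lookup-++ʳ; ++-cong)
open import Function using (_∘_)
open import Relation.Binary.PropositionalEquality hiding ([_])
open import Relation.Nullary using (yes; no; ¬_)
open import Relation.Nullary.Reflects using (Reflects; ofʸ; ofⁿ; det; fromEquivalence)

clamp : ∀ q → ℕ → Fin (suc q)
clamp q       zero    = zero
clamp zero    (suc t) = zero
clamp (suc q) (suc t) = suc (clamp q t)

toℕ-clamp : ∀ q {t} → t ≤ q → toℕ (clamp q t) ≡ t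
toℕ-clamp q       z≤n       = refl
toℕ-clamp (suc q) (s≤s t≤q) = cong suc (toℕ-clamp q t≤q)

clamp-toℕ : ∀ q (k : Fin (suc q)) → clamp q (toℕ k) ≡ k
clamp-toℕ q       zero    = refl
clamp-toℕ (suc q) (suc k) = cong suc (clamp-toℕ q k)

↑-ind : ∀ m n (P : Fin (m ℕ.+ n) → Set) → (∀ i → P (i ↑ˡ n)) → (∀ j → P (m ↑ʳ j)) → ∀ v → P v
↑-ind m n P left right v = subst P (join-splitAt m n v) ([_,_] {C = P ∘ join m n} left right (splitAt m v))

zipWith-++ : ∀ {m n} {X Y Z : Set} (_⊕_ : X → Y → Z) (xs : Fin m → X) (ys : Fin n → X) xs′ ys′ →
  zipWith _⊕_ (xs ++ ys) (xs′ ++ ys′) ≗ zipWith _⊕_ xs xs′ ++ zipWith _⊕_ ys ys′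
zipWith-++ {m} _⊕_ xs ys xs′ ys′ v = go (splitAt m v)
  where
  go : ∀ s → [ xs , ys ]′ s ⊕ [ xs′ , ys′ ]′ s ≡ [ zipWith _⊕_ xs xs′ , zipWith _⊕_ ys ys′ ]′ s
  go (inj₁ i) = refl
  go (inj₂ j) = refl

map-++ : ∀ {m n} {X Y : Set} (f : X → Y) (xs : Fin m → X) (ys : Fin n → X) → map f (xs ++ ys) ≗ map f xs ++ map f ys
map-++ {m} f xs ys v = go (splitAt m v)
  where
  go : ∀ s → f ([ xs , ys ]′ s) ≡ [ map f xs , map f ys ]′ s
  go (inj₁ i) = refl
  go (inj₂ j) = refl

≡ᵇ-reflects-≡ : ∀ m n → Reflects (m ≡ n) (m ≡ᵇ n)
≡ᵇ-reflects-≡ m n = fromEquivalence (ℕₚ.≡ᵇ⇒≡ m n) (ℕₚ.≡⇒≡ᵇ m n)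

≡ᵇ-sym : ∀ m n → (m ≡ᵇ n) ≡ (n ≡ᵇ m)
≡ᵇ-sym m n = det (≡ᵇ-reflects-≡ m n) (fromEquivalence (sym ∘ ℕₚ.≡ᵇ⇒≡ n m) (ℕₚ.≡⇒≡ᵇ n m ∘ sym))

suc[m/n]*n≡m+[n∸m%n] : ∀ m n .{{_ : ℕ.NonZero n}} → suc (m / n) ℕ.* n ≡ m ℕ.+ (n ℕ.∸ m % n)
suc[m/n]*n≡m+[n∸m%n] m n = begin
  n ℕ.+ m / n ℕ.* n                          ≡⟨ cong (ℕ._+ m / n ℕ.* n) (ℕₚ.m+[n∸m]≡n (ℕₚ.<⇒≤ (m%n<n m n))) ⟨
  m % n ℕ.+ (n ℕ.∸ m % n) ℕ.+ m / n ℕ.* n    ≡⟨ ℕₚ.+-assoc (m % n) _ _ ⟩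
  m % n ℕ.+ ((n ℕ.∸ m % n) ℕ.+ m / n ℕ.* n)  ≡⟨ cong (m % n ℕ.+_) (ℕₚ.+-comm (n ℕ.∸ m % n) _) ⟩
  m % n ℕ.+ (m / n ℕ.* n ℕ.+ (n ℕ.∸ m % n))  ≡⟨ ℕₚ.+-assoc (m % n) _ _ ⟨
  m % n ℕ.+ m / n ℕ.* n ℕ.+ (n ℕ.∸ m % n)    ≡⟨ cong (ℕ._+ (n ℕ.∸ m % n)) (m≡m%n+[m/n]*n m n) ⟨
  m ℕ.+ (n ℕ.∸ m % n)                        ∎
  where open ≡-Reasoning

-- x is the sequence of remainders in the negative (Hirzebruch–Jung) continued fraction
-- a / b = c 1 − 1 / (c 2 − 1 / (⋯ − 1 / c len)).
record NegativeContinuedFraction (a b : ℕ) : Set where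
  field
    len        : ℕ
    1≤len      : 1 ≤ len
    x c        : ℕ → ℕ
    x₀         : x 0 ≡ a
    x₁         : x 1 ≡ b
    x-len      : x len ≡ 1
    x-suc-len  : x (suc len) ≡ 0
    x-pos      : ∀ j → 1 ≤ j → j ≤ len → 1 ≤ x j
    recurrence : ∀ j → 1 ≤ j → j ≤ len → c j ℕ.* x j ≡ x (pred j) ℕ.+ x (suc j)

negativeContinuedFraction : ∀ a b → 1 ≤ b → Coprime a b → NegativeContinuedFraction a b
negativeContinuedFraction a b = <-rec (λ b → ∀ a → 1 ≤ b → Coprime a b → NegativeContinuedFraction a b) step b a
  where
  step : ∀ b → (∀ {b′} → b′ < b → ∀ a → 1 ≤ b′ → Coprime a b′ → NegativeContinuedFraction a b′) →
         ∀ a → 1 ≤ b → Coprime a b → NegativeContinuedFraction a b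
  step (suc zero) _ a _ _ = record
    { len = 1 ; 1≤len = ℕₚ.≤-refl ; x = x ; c = λ _ → a
    ; x₀ = refl ; x₁ = refl ; x-len = refl ; x-suc-len = refl
    ; x-pos = λ { (suc zero) _ _ → ℕₚ.≤-refl ; (suc (suc _)) _ (s≤s ()) }
    ; recurrence = λ { (suc zero) _ _ → trans (ℕₚ.*-identityʳ a) (sym (ℕₚ.+-identityʳ a))
                     ; (suc (suc _)) _ (s≤s ()) } }
    where
    x : ℕ → ℕ
    x zero          = a
    x (suc zero)    = 1
    x (suc (suc _)) = 0
  -- a = suc (a / b) * b − b′ with 0 < b′ < b and b′ coprime to b: prepend a to the chain of (b, b′).
  step b@(suc (suc _)) rec a _ a⊥b = record
    { len = suc C.len ; 1≤len = s≤s z≤n ; x = x ; c = c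
    ; x₀ = refl ; x₁ = C.x₀ ; x-len = C.x-len ; x-suc-len = C.x-suc-len
    ; x-pos = x-pos ; recurrence = recurrence }
    where
    b′ : ℕ
    b′ = b ℕ.∸ a % b

    a%b≢0 : a % b ≢ 0
    a%b≢0 a%b≡0 with a⊥b (m%n≡0⇒n∣m a b a%b≡0 , ∣-refl)
    ... | ()

    b′<b : b′ < b
    b′<b = ℕₚ.∸-monoʳ-< (ℕₚ.n≢0⇒n>0 a%b≢0) (ℕₚ.<⇒≤ (m%n<n a b))

    b⊥b′ : Coprime b b′
    b⊥b′ {d} (d∣b , d∣b′) = a⊥b (∣m+n∣m⇒∣n d∣b′+a d∣b′ , d∣b)
      where
      d∣b′+a : d ∣ b′ ℕ.+ a
      d∣b′+a = subst (d ∣_) (trans (suc[m/n]*n≡m+[n∸m%n] a b) (ℕₚ.+-comm a b′)) (∣n⇒∣m*n (suc (a / b)) d∣b)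

    module C = NegativeContinuedFraction (rec b′<b b (ℕₚ.m<n⇒0<n∸m (m%n<n a b)) b⊥b′)

    x : ℕ → ℕ
    x zero    = a
    x (suc j) = C.x j

    c : ℕ → ℕ
    c zero          = 0
    c (suc zero)    = suc (a / b)
    c (suc (suc j)) = C.c (suc j)

    x-pos : ∀ j → 1 ≤ j → j ≤ suc C.len → 1 ≤ x j
    x-pos (suc zero)    _ _         = subst (1 ≤_) (sym C.x₀) (s≤s z≤n)
    x-pos (suc (suc j)) _ (s≤s j<l) = C.x-pos (suc j) (s≤s z≤n) j<l

    recurrence : ∀ j → 1 ≤ j → j ≤ suc C.len → c j ℕ.* x j ≡ x (pred j) ℕ.+ x (suc j)
    recurrence (suc zero)    _ _ = trans (cong (suc (a / b) ℕ.*_) C.x₀)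
                                         (trans (suc[m/n]*n≡m+[n∸m%n] a b) (cong (a ℕ.+_) (sym C.x₁)))
    recurrence (suc (suc j)) _ (s≤s j<l) = C.recurrence (suc j) (s≤s z≤n) j<l

module IntegerLinearAlgebra where

  open import Data.Integer using (ℤ; +_; 0ℤ; 1ℤ; _+_; _-_; _*_; -_)

  sumFin-cong : ∀ n {f g : Fin n → ℤ} → (∀ i → f i ≡ g i) → sumFin n f ≡ sumFin n g
  sumFin-cong zero    f≗g = refl
  sumFin-cong (suc n) f≗g = cong₂ _+_ (f≗g zero) (sumFin-cong n (f≗g ∘ suc))

  sumFin-zero : ∀ n {f : Fin n → ℤ} → (∀ i → f i ≡ 0ℤ) → sumFin n f ≡ 0ℤ
  sumFin-zero zero    f≗0 = refl
  sumFin-zero (suc n) f≗0 = cong₂ _+_ (f≗0 zero) (sumFin-zero n (f≗0 ∘ suc))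

  sumFin-distrib-+ : ∀ n (f g : Fin n → ℤ) → sumFin n (λ i → f i + g i) ≡ sumFin n f + sumFin n g
  sumFin-distrib-+ zero    f g = refl
  sumFin-distrib-+ (suc n) f g =
    trans (cong (_+_ (f zero + g zero)) (sumFin-distrib-+ n (f ∘ suc) (g ∘ suc)))
          (interchange (f zero) (g zero) _ _)
    where
    interchange : ∀ a b c d → (a + b) + (c + d) ≡ (a + c) + (b + d)
    interchange = solve-∀

  sumFin-neg : ∀ n (f : Fin n → ℤ) → sumFin n (λ i → - f i) ≡ - sumFin n f
  sumFin-neg zero    f = refl
  sumFin-neg (suc n) f =
    trans (cong (_+_ (- f zero)) (sumFin-neg n (f ∘ suc))) (sym (ℤₚ.neg-distrib-+ (f zero) _))

  sumFin-distrib-- : ∀ n (f g : Fin n → ℤ) → sumFin n (λ i → f i - g i) ≡ sumFin n f - sumFin n g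
  sumFin-distrib-- n f g =
    trans (sumFin-distrib-+ n f (λ i → - g i)) (cong (_+_ (sumFin n f)) (sumFin-neg n g))

  *-distribˡ-sumFin : ∀ n c (f : Fin n → ℤ) → sumFin n (λ i → c * f i) ≡ c * sumFin n f
  *-distribˡ-sumFin zero    c f = sym (ℤₚ.*-zeroʳ c)
  *-distribˡ-sumFin (suc n) c f =
    trans (cong (_+_ (c * f zero)) (*-distribˡ-sumFin n c (f ∘ suc))) (sym (ℤₚ.*-distribˡ-+ c (f zero) _))

  sumFin-comm : ∀ m n (f : Fin m → Fin n → ℤ) →
    sumFin m (λ i → sumFin n (f i)) ≡ sumFin n (λ j → sumFin m (λ i → f i j))
  sumFin-comm zero    n f = sym (sumFin-zero n (λ _ → refl))
  sumFin-comm (suc m) n f =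
    trans (cong (_+_ (sumFin n (f zero))) (sumFin-comm m n (f ∘ suc)))
          (sym (sumFin-distrib-+ n (f zero) (λ j → sumFin m (λ i → f (suc i) j))))

  sumFin-++ : ∀ m n (f : Fin (m ℕ.+ n) → ℤ) →
    sumFin (m ℕ.+ n) f ≡ sumFin m (λ i → f (i ↑ˡ n)) + sumFin n (λ j → f (m ↑ʳ j))
  sumFin-++ zero    n f = sym (ℤₚ.+-identityˡ _)
  sumFin-++ (suc m) n f =
    trans (cong (_+_ (f zero)) (sumFin-++ m n (f ∘ suc))) (sym (ℤₚ.+-assoc (f zero) _ _))

  sumFin-pos : ∀ n (f : Fin n → ℕ) → sumFin n (λ i → + f i) ≡ + sum (tabulate f)
  sumFin-pos zero    f = refl
  sumFin-pos (suc n) f =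
    trans (cong (_+_ (+ f zero)) (sumFin-pos n (f ∘ suc))) (sym (ℤₚ.pos-+ (f zero) _))

  sumFin-divisible : ∀ n {k} (f : Fin n → ℤ) → (∀ i → k DS.∣ f i) → k DS.∣ sumFin n f
  sumFin-divisible zero {k} f k∣f = DS.divides 0ℤ (sym (ℤₚ.*-zeroˡ k))
  sumFin-divisible (suc n) f k∣f = DS.∣m∣n⇒∣m+n (k∣f zero) (sumFin-divisible n (f ∘ suc) (k∣f ∘ suc))

  sumFin-δ : ∀ n (i : Fin n) (g : Fin n → ℤ) →
    sumFin n (λ j → if toℕ i ≡ᵇ toℕ j then g j else 0ℤ) ≡ g i
  sumFin-δ (suc n) zero    g = trans (cong (_+_ (g zero)) (sumFin-zero n (λ _ → refl))) (ℤₚ.+-identityʳ (g zero))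
  sumFin-δ (suc n) (suc i) g = trans (ℤₚ.+-identityˡ _) (sumFin-δ n i (g ∘ suc))

  sumFin-indicator : ∀ q t (g : Fin (suc q) → ℤ) →
    sumFin (suc q) (λ k → if toℕ k ≡ᵇ t then g k else 0ℤ) ≡ (if t <ᵇ suc q then g (clamp q t) else 0ℤ)
  sumFin-indicator q       zero    g = trans (cong (_+_ (g zero)) (sumFin-zero q (λ _ → refl))) (ℤₚ.+-identityʳ (g zero))
  sumFin-indicator zero    (suc t) g = refl
  sumFin-indicator (suc q) (suc t) g = trans (ℤₚ.+-identityˡ _) (sumFin-indicator q t (g ∘ suc))

  diagMinus-row : ∀ {n} (d : Fin n → ℕ) (A : Matℤ n) (y : Vecℤ n) i →
    (diagMinus d A · y) i ≡ + d i * y i - (A · y) i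
  diagMinus-row {n} d A y i = begin
    sumFin n (λ j → (δ j - A i j) * y j)
      ≡⟨ sumFin-cong n (λ j → [y-z]x≈yx-zx (y j) (δ j) (A i j)) ⟩
    sumFin n (λ j → δ j * y j - A i j * y j)
      ≡⟨ sumFin-distrib-- n _ _ ⟩
    sumFin n (λ j → δ j * y j) - (A · y) i
      ≡⟨ cong (_- (A · y) i) (trans (sumFin-cong n δ*y) (sumFin-δ n i (λ j → + d i * y j))) ⟩
    + d i * y i - (A · y) i ∎
    where
    open ≡-Reasoning
    δ : Fin n → ℤ
    δ j = if toℕ i ≡ᵇ toℕ j then + d i else 0ℤ
    δ*y : ∀ j → δ j * y j ≡ (if toℕ i ≡ᵇ toℕ j then + d i * y j else 0ℤ)
    δ*y j with toℕ i ≡ᵇ toℕ j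
    ... | true  = refl
    ... | false = ℤₚ.*-zeroˡ (y j)

  diagMinus-sym : ∀ {n} (d : Fin n → ℕ) (A : Matℤ n) → (∀ i j → A i j ≡ A j i) →
    ∀ i j → diagMinus d A i j ≡ diagMinus d A j i
  diagMinus-sym d A A-sym i j with i ≟ j
  ... | yes refl = refl
  ... | no i≢j   = cong₂ _-_ (trans (cong (λ b → if b then + d i else 0ℤ) (≡ᵇ-false i≢j))
                                    (sym (cong (λ b → if b then + d j else 0ℤ) (≡ᵇ-false (i≢j ∘ sym)))))
                             (A-sym i j)
    where
    ≡ᵇ-false : ∀ {i j : Fin _} → i ≢ j → (toℕ i ≡ᵇ toℕ j) ≡ false
    ≡ᵇ-false i≢j = det (≡ᵇ-reflects-≡ _ _) (ofⁿ (i≢j ∘ toℕ-injective))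

  ·-distrib-- : ∀ {n} (M : Matℤ n) (y y′ : Vecℤ n) → M · (y -ᵥ y′) ≗ (M · y) -ᵥ (M · y′)
  ·-distrib-- {n} M y y′ i =
    trans (sumFin-cong n (λ j → x[y-z]≈xy-xz (M i j) (y j) (y′ j))) (sumFin-distrib-- n _ _)

  InImage-resp : ∀ {n} (M : Matℤ n) {x x′ : Vecℤ n} → x ≗ x′ → InImage M x → InImage M x′
  InImage-resp M x≗x′ (y , x≡My) = y , λ i → trans (sym (x≗x′ i)) (x≡My i)

  InImage-self : ∀ {n} (M : Matℤ n) (y : Vecℤ n) → InImage M (M · y)
  InImage-self M y = y , λ _ → refl

  InImage-sub : ∀ {n} (M : Matℤ n) {x x′ : Vecℤ n} → InImage M x → InImage M x′ → InImage M (x -ᵥ x′)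
  InImage-sub M (y , x≡My) (y′ , x′≡My′) =
    y -ᵥ y′ , λ i → trans (cong₂ _-_ (x≡My i) (x′≡My′ i)) (sym (·-distrib-- M y y′ i))

  dot : ∀ {n} → Vecℤ n → Vecℤ n → ℤ
  dot {n} r z = sumFin n (λ i → r i * z i)

  dot-distrib-- : ∀ {n} (r x z : Vecℤ n) → dot r (x -ᵥ z) ≡ dot r x - dot r z
  dot-distrib-- {n} r x z = trans (sumFin-cong n (λ i → x[y-z]≈xy-xz (r i) (x i) (z i))) (sumFin-distrib-- n _ _)

  module _ {n} (M : Matℤ n) (M-sym : ∀ i j → M i j ≡ M j i) (r : Vecℤ n) (Mr≡0 : ∀ i → (M · r) i ≡ 0ℤ) where

    kernel⊥image : ∀ y → dot r (M · y) ≡ 0ℤ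
    kernel⊥image y = begin
      sumFin n (λ i → r i * (M · y) i)
        ≡⟨ sumFin-cong n (λ i → sym (*-distribˡ-sumFin n (r i) (λ j → M i j * y j))) ⟩
      sumFin n (λ i → sumFin n (λ j → r i * (M i j * y j)))
        ≡⟨ sumFin-comm n n _ ⟩
      sumFin n (λ j → sumFin n (λ i → r i * (M i j * y j)))
        ≡⟨ sumFin-cong n (λ j → trans (sumFin-cong n (λ i → trans (reorder (r i) (M i j) (y j))
                                                                   (cong (λ a → y j * (a * r i)) (M-sym i j))))
                                      (*-distribˡ-sumFin n (y j) (λ i → M j i * r i))) ⟩
      sumFin n (λ j → y j * (M · r) j)
        ≡⟨ sumFin-zero n (λ j → trans (cong (y j *_) (Mr≡0 j)) (ℤₚ.*-zeroʳ (y j))) ⟩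
      0ℤ ∎
      where
      open ≡-Reasoning
      reorder : ∀ a b c → a * (b * c) ≡ c * (b * a)
      reorder = solve-∀

    torsion⊥kernel : ∀ {x} → IsTorsion M x → dot r x ≡ 0ℤ
    torsion⊥kernel {x} (suc t , _ , y , tx≡My) = ℤₚ.*-cancelˡ-≡ (+ suc t) (dot r x) 0ℤ (begin
      + suc t * dot r x                        ≡⟨ *-distribˡ-sumFin n (+ suc t) _ ⟨
      sumFin n (λ i → + suc t * (r i * x i))   ≡⟨ sumFin-cong n (λ i → trans (swap (+ suc t) (r i) (x i))
                                                                            (cong (r i *_) (tx≡My i))) ⟩
      dot r (M · y)                            ≡⟨ kernel⊥image y ⟩
      0ℤ                                       ≡⟨ ℤₚ.*-zeroʳ (+ suc t) ⟨
      + suc t * 0ℤ                             ∎)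
      where
      open ≡-Reasoning
      swap : ∀ a b c → a * (b * c) ≡ b * (a * c)
      swap = solve-∀

  backSubstitution : ∀ p (c x : ℕ → ℤ) → ∃ λ Y → Y (suc p) ≡ 0ℤ ×
    (∀ j → 1 ≤ j → j ≤ p → c j * Y j - (Y (suc j) + Y (pred j)) ≡ x j)
  backSubstitution p c x = Y , cong Z (ℕₚ.n∸n≡0 p) , solves
    where
    -- Z t = Y (suc p ∸ t): the unknowns are determined one by one from the end of the system.
    Z : ℕ → ℤ
    Z zero          = 0ℤ
    Z (suc zero)    = 0ℤ
    Z (suc (suc t)) = c (p ℕ.∸ t) * Z (suc t) - Z t - x (p ℕ.∸ t)

    Y : ℕ → ℤ
    Y j = Z (suc p ℕ.∸ j)

    solves : ∀ j → 1 ≤ j → j ≤ p → c j * Y j - (Y (suc j) + Y (pred j)) ≡ x j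
    solves (suc a) _ a<p = begin
      c (suc a) * Y (suc a) - (Y (suc (suc a)) + Y a)
        ≡⟨ cong₂ (λ y y′ → c (suc a) * y - (Z t + y′))
                 (cong Z p∸a≡1+t) (cong Z (trans (ℕₚ.+-∸-assoc 1 (ℕₚ.<⇒≤ a<p)) (cong suc p∸a≡1+t))) ⟩
      c (suc a) * Z (suc t) - (Z t + (c (p ℕ.∸ t) * Z (suc t) - Z t - x (p ℕ.∸ t)))
        ≡⟨ cong (λ k → c (suc a) * Z (suc t) - (Z t + (c k * Z (suc t) - Z t - x k))) (ℕₚ.m∸[m∸n]≡n a<p) ⟩
      c (suc a) * Z (suc t) - (Z t + (c (suc a) * Z (suc t) - Z t - x (suc a)))
        ≡⟨ cancel (c (suc a) * Z (suc t)) (Z t) (x (suc a)) ⟩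
      x (suc a) ∎
      where
      open ≡-Reasoning
      t : ℕ
      t = p ℕ.∸ suc a
      p∸a≡1+t : p ℕ.∸ a ≡ suc t
      p∸a≡1+t = ℕₚ.+-∸-assoc 1 a<p
      cancel : ∀ u z w → u - (z + (u - z - w)) ≡ w
      cancel = solve-∀

  DivisibleBy : ∀ {m} → (Fin m → ℕ) → Vecℤ m → Set
  DivisibleBy D z = ∀ i → + D i ∣ℤ z i

  module _ {c ℓ} {G : AbelianGroup c ℓ} {k} {a : Fin k → ℕ} (l : ℕ) where

    private
      DivisibleBy-++⁺ : ∀ z {z′} → (∀ i → z (i ↑ˡ l) ≡ z′ i) → DivisibleBy a z′ → DivisibleBy (a ++ λ _ → 1) z
      DivisibleBy-++⁺ z z≗z′ a∣z′ = ↑-ind k l (λ v → + (a ++ λ _ → 1) v ∣ℤ z v)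
        (λ i → subst₂ (λ d t → + d ∣ℤ t) (sym (lookup-++ˡ a _ i)) (sym (z≗z′ i)) (a∣z′ i))
        (λ j → subst (λ d → + d ∣ℤ z (k ↑ʳ j)) (sym (lookup-++ʳ a _ j)) (1∣ _))

      DivisibleBy-++⁻ : ∀ z {z′} → (∀ i → z (i ↑ˡ l) ≡ z′ i) → DivisibleBy (a ++ λ _ → 1) z → DivisibleBy a z′
      DivisibleBy-++⁻ z z≗z′ a∣z i = subst₂ (λ d t → + d ∣ℤ t) (lookup-++ˡ a _ i) (z≗z′ i) (a∣z (i ↑ˡ l))

    IsoToSubquotient-pad : IsoToSubquotient G k (λ _ → ⊤) (DivisibleBy a) →
                           IsoToSubquotient G (k ℕ.+ l) (λ _ → ⊤) (DivisibleBy (a ++ λ _ → 1))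
    IsoToSubquotient-pad iso = record
      { φ            = φ′
      ; φ-lands      = λ _ → tt
      ; φ-wellDef    = λ g h g≈h → DivisibleBy-++⁺ (φ′ g -ᵥ φ′ h) (left-- g h) (φ-wellDef g h g≈h)
      ; φ-injective  = λ g h a∣g-h → φ-injective g h (DivisibleBy-++⁻ (φ′ g -ᵥ φ′ h) (left-- g h) a∣g-h)
      ; φ-hom        = λ g h → DivisibleBy-++⁺ (φ′ (g ∙ h) -ᵥ (φ′ g +ᵥ φ′ h))
                                 (λ i → cong₂ _-_ (left (g ∙ h) i) (cong₂ _+_ (left g i) (left h i))) (φ-hom g h)
      ; φ-surjective = λ z _ → let g , a∣φg-z = φ-surjective (λ i → z (i ↑ˡ l)) tt
                               in g , DivisibleBy-++⁺ (φ′ g -ᵥ z) (λ i → cong (_- z (i ↑ˡ l)) (left g i)) a∣φg-z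
      }
      where
      open AbelianGroup G using (Carrier; _∙_)
      open IsoToSubquotient iso
      φ′ : Carrier → Vecℤ (k ℕ.+ l)
      φ′ g = φ g ++ λ _ → 0ℤ
      left : ∀ g i → φ′ g (i ↑ˡ l) ≡ φ g i
      left g = lookup-++ˡ (φ g) _
      left-- : ∀ g h i → (φ′ g -ᵥ φ′ h) (i ↑ˡ l) ≡ (φ g -ᵥ φ h) i
      left-- g h i = cong₂ _-_ (left g i) (left h i)

  -- embed induces an isomorphism from ⊕ᵢ ℤ / D i onto the torsion subgroup of ℤⁿ / im M.
  record DiagonalPresentation {n m} (M : Matℤ n) (D : Fin m → ℕ) : Set where
    field
      embed            : Vecℤ m → Vecℤ n
      embed-+          : ∀ u u′ → embed (u +ᵥ u′) ≗ embed u +ᵥ embed u′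
      embed-neg        : ∀ u → embed (λ i → - u i) ≗ λ v → - embed u v
      embed-torsion    : ∀ u → IsTorsion M (embed u)
      divisible⇒image  : ∀ u → DivisibleBy D u → InImage M (embed u)
      image⇒divisible  : ∀ u → InImage M (embed u) → DivisibleBy D u
      torsion⇒embed    : ∀ w → IsTorsion M w → ∃ λ u → InImage M (w -ᵥ embed u)

    embed-- : ∀ u u′ → embed (u -ᵥ u′) ≗ embed u -ᵥ embed u′
    embed-- u u′ v = trans (embed-+ u (λ i → - u′ i) v) (cong (_+_ (embed u v)) (embed-neg u′ v))

  DiagonalPresentation⇒IsoToSubquotient : ∀ {c ℓ} {G : AbelianGroup c ℓ} {n m} {M : Matℤ n} {D : Fin m → ℕ} →
    IsoToSubquotient G m (λ _ → ⊤) (DivisibleBy D) → DiagonalPresentation M D →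
    IsoToSubquotient G n (IsTorsion M) (InImage M)
  DiagonalPresentation⇒IsoToSubquotient {G = G} {m = m} {M = M} {D} iso pres = record
    { φ            = embed ∘ φ
    ; φ-lands      = embed-torsion ∘ φ
    ; φ-wellDef    = λ g h g≈h → InImage-resp M (embed-- (φ g) (φ h)) (divisible⇒image _ (φ-wellDef g h g≈h))
    ; φ-injective  = λ g h im → φ-injective g h (image⇒divisible _ (InImage-resp M (sym ∘ embed-- (φ g) (φ h)) im))
    ; φ-hom        = λ g h → InImage-resp M (embed-hom g h) (divisible⇒image _ (φ-hom g h))
    ; φ-surjective = surjective
    }
    where
    open AbelianGroup G using (Carrier; _∙_)
    open IsoToSubquotient iso
    open DiagonalPresentation pres

    embed-hom : ∀ g h → embed (φ (g ∙ h) -ᵥ (φ g +ᵥ φ h)) ≗ embed (φ (g ∙ h)) -ᵥ (embed (φ g) +ᵥ embed (φ h))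
    embed-hom g h v = trans (embed-- (φ (g ∙ h)) _ v) (cong (_-_ (embed (φ (g ∙ h)) v)) (embed-+ (φ g) (φ h) v))

    surjective : ∀ x → IsTorsion M x → ∃ λ g → InImage M (embed (φ g) -ᵥ x)
    surjective x x-torsion = g , InImage-resp M (λ v → cancel (embed (φ g) v) (embed u v) (x v))
      (InImage-sub M (InImage-resp M (embed-- (φ g) u) (divisible⇒image _ D∣φg-u)) x-embed-u∈im)
      where
      u : Vecℤ m
      u = proj₁ (torsion⇒embed x x-torsion)
      x-embed-u∈im : InImage M (x -ᵥ embed u)
      x-embed-u∈im = proj₂ (torsion⇒embed x x-torsion)
      g : Carrier
      g = proj₁ (φ-surjective u tt)
      D∣φg-u : DivisibleBy D (φ g -ᵥ u)
      D∣φg-u = proj₂ (φ-surjective u tt)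
      cancel : ∀ a b z → (a - b) - (z - b) ≡ a - z
      cancel = solve-∀

open IntegerLinearAlgebra

module Broom (p q : ℕ) where

  open import Data.Integer using (_+_; _-_; _*_)

  A : Matℤ (suc (p ℕ.+ q))
  A = broomAdj p q

  edgeᵇ : ℕ → ℕ → Bool
  edgeᵇ a b = broomEdgeᵇ p a b ∨ broomEdgeᵇ p b a

  A-sym : ∀ u v → A u v ≡ A v u
  A-sym u v = cong (λ b → if b then 1ℤ else 0ℤ) (∨-comm (broomEdgeᵇ p (toℕ u) (toℕ v)) _)

  private
    ≤ᵇ-true : ∀ {m n} → m ≤ n → (m ≤ᵇ n) ≡ true
    ≤ᵇ-true m≤n = det (ℕₚ.≤ᵇ-reflects-≤ _ _) (ofʸ m≤n)

    ≤ᵇ-false : ∀ {m n} → n < m → (m ≤ᵇ n) ≡ false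
    ≤ᵇ-false n<m = det (ℕₚ.≤ᵇ-reflects-≤ _ _) (ofⁿ (ℕₚ.<⇒≱ n<m))

    <ᵇ-true : ∀ {m n} → m < n → (m <ᵇ n) ≡ true
    <ᵇ-true m<n = det (ℕₚ.<ᵇ-reflects-< _ _) (ofʸ m<n)

    <ᵇ-false : ∀ {m n} → n ≤ m → (m <ᵇ n) ≡ false
    <ᵇ-false n≤m = det (ℕₚ.<ᵇ-reflects-< _ _) (ofⁿ (ℕₚ.≤⇒≯ n≤m))

    ≡ᵇ-false : ∀ {m n} → m ≢ n → (m ≡ᵇ n) ≡ false
    ≡ᵇ-false m≢n = det (≡ᵇ-reflects-≡ _ _) (ofⁿ m≢n)

    p<prong : ∀ t → p < suc (p ℕ.+ t)
    p<prong t = s≤s (ℕₚ.m≤m+n p t)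

  edge-centre-path : ∀ b → b ≤ p → edgeᵇ 0 b ≡ (b ≡ᵇ 1)
  edge-centre-path zero          _   = refl
  edge-centre-path (suc zero)    1≤p rewrite ≤ᵇ-true 1≤p = refl
  edge-centre-path (suc (suc b)) b≤p rewrite <ᵇ-false b≤p = refl

  edge-centre-prong : ∀ t → edgeᵇ 0 (suc (p ℕ.+ t)) ≡ true
  edge-centre-prong t rewrite ≤ᵇ-false (p<prong t) | <ᵇ-true (p<prong t) with 0 ≡ᵇ p ℕ.+ t
  ... | true  = refl
  ... | false = refl

  edge-path-path : ∀ a → suc a ≤ p → ∀ b → b ≤ p → edgeᵇ (suc a) b ≡ (b ≡ᵇ suc (suc a)) ∨ (b ≡ᵇ a)
  edge-path-path a a<p b b≤p
    rewrite ≤ᵇ-true b≤p | ≤ᵇ-true a<p | <ᵇ-false a<p | ≡ᵇ-sym b (suc (suc a))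
    with suc (suc a) ≡ᵇ b | b ≡ᵇ a | b ≡ᵇ 0
  ... | true  | _     | _     = refl
  ... | false | true  | _     = refl
  ... | false | false | true  = refl
  ... | false | false | false = refl

  edge-path-prong : ∀ a → suc a ≤ p → ∀ t → edgeᵇ (suc a) (suc (p ℕ.+ t)) ≡ false
  edge-path-prong a a<p t
    rewrite ≤ᵇ-false (p<prong t) | ≡ᵇ-false {suc (p ℕ.+ t)} {a} (ℕₚ.>⇒≢ (ℕₚ.<-trans a<p (p<prong t)))
    with suc a ≡ᵇ p ℕ.+ t
  ... | true  = refl
  ... | false = refl

  edge-prong-path : ∀ s b → b ≤ p → edgeᵇ (suc (p ℕ.+ s)) b ≡ (b ≡ᵇ 0)
  edge-prong-path s b b≤p
    rewrite ≤ᵇ-false (p<prong s) | <ᵇ-true (p<prong s)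
          | ≡ᵇ-false {suc (suc (p ℕ.+ s))} {b} (ℕₚ.>⇒≢ (ℕₚ.<-trans (s≤s b≤p) (s≤s (p<prong s))))
    with b ≡ᵇ p ℕ.+ s | b ≡ᵇ 0
  ... | true  | true  = refl
  ... | true  | false = refl
  ... | false | true  = refl
  ... | false | false = refl

  edge-prong-prong : ∀ s t → edgeᵇ (suc (p ℕ.+ s)) (suc (p ℕ.+ t)) ≡ false
  edge-prong-prong s t
    rewrite ≤ᵇ-false (p<prong s) | ≤ᵇ-false (p<prong t)
    with suc (p ℕ.+ s) ≡ᵇ p ℕ.+ t | suc (p ℕ.+ t) ≡ᵇ p ℕ.+ s
  ... | true  | true  = refl
  ... | true  | false = refl
  ... | false | true  = refl
  ... | false | false = refl

  pathV : ℕ → Fin (suc (p ℕ.+ q))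
  pathV j = clamp p j ↑ˡ q

  prong : Fin q → Fin (suc (p ℕ.+ q))
  prong s = suc p ↑ʳ s

  toℕ-pathV : ∀ {j} → j ≤ p → toℕ (pathV j) ≡ j
  toℕ-pathV {j} j≤p = trans (toℕ-↑ˡ (clamp p j) q) (toℕ-clamp p j≤p)

  path-ind : (P : Fin (suc (p ℕ.+ q)) → Set) → P zero → (∀ j → 1 ≤ j → j ≤ p → P (pathV j)) → ∀ k → P (k ↑ˡ q)
  path-ind P centre path zero    = centre
  path-ind P centre path (suc k) =
    subst (λ k → P (k ↑ˡ q)) (clamp-toℕ p (suc k)) (path (suc (toℕ k)) (s≤s z≤n) (toℕ≤pred[n] (suc k)))

  broom-ind : (P : Fin (suc (p ℕ.+ q)) → Set) → P zero → (∀ j → 1 ≤ j → j ≤ p → P (pathV j)) →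
              (∀ s → P (prong s)) → ∀ v → P v
  broom-ind P centre path = ↑-ind (suc p) q P (path-ind P centre path)

  pathExt : Vecℤ (suc (p ℕ.+ q)) → ℕ → ℤ
  pathExt y j = if j <ᵇ suc p then y (pathV j) else 0ℤ

  pathExt-≤ : ∀ y {j} → j ≤ p → pathExt y j ≡ y (pathV j)
  pathExt-≤ y j≤p rewrite <ᵇ-true (s≤s j≤p) = refl

  pathExt-suc : ∀ y → pathExt y (suc p) ≡ 0ℤ
  pathExt-suc y rewrite <ᵇ-false {suc p} ℕₚ.≤-refl = refl

  broomVec : ∀ {X : Set} → (ℕ → X) → (Fin q → X) → Fin (suc (p ℕ.+ q)) → X
  broomVec f g = (f ∘ toℕ {suc p}) ++ g

  lookup-pathV : ∀ {X : Set} (f : ℕ → X) (g : Fin q → X) {j} → j ≤ p → broomVec f g (pathV j) ≡ f j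
  lookup-pathV f g j≤p = trans (lookup-++ˡ (f ∘ toℕ {suc p}) g (clamp p _)) (cong f (toℕ-clamp p j≤p))

  lookup-prong : ∀ {X : Set} (f : ℕ → X) (g : Fin q → X) s → broomVec f g (prong s) ≡ g s
  lookup-prong f g = lookup-++ʳ (f ∘ toℕ {suc p}) g

  broomVec-cong : ∀ {X : Set} {f f′ : ℕ → X} {g g′ : Fin q → X} → (∀ j → f j ≡ f′ j) → g ≗ g′ →
                  broomVec f g ≗ broomVec f′ g′
  broomVec-cong f≗f′ g≗g′ = ++-cong _ _ (f≗f′ ∘ toℕ) g≗g′

  broomVec-zipWith : ∀ {X Y Z : Set} (_⊕_ : X → Y → Z) f g f′ g′ →
    zipWith _⊕_ (broomVec f g) (broomVec f′ g′) ≗ broomVec (λ j → f j ⊕ f′ j) (zipWith _⊕_ g g′)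
  broomVec-zipWith _⊕_ f g f′ g′ = zipWith-++ _⊕_ (f ∘ toℕ {suc p}) g (f′ ∘ toℕ) g′

  broomVec-map : ∀ {X Y : Set} (h : X → Y) f g → map h (broomVec f g) ≗ broomVec (h ∘ f) (map h g)
  broomVec-map h f g = map-++ h (f ∘ toℕ {suc p}) g

  pathExt-≗ : ∀ z (f : ℕ → ℤ) → (∀ {j} → j ≤ p → z (pathV j) ≡ f j) → f (suc p) ≡ 0ℤ →
              ∀ {t} → t ≤ suc p → pathExt z t ≡ f t
  pathExt-≗ z f z≗f f[1+p]≡0 t≤1+p with ℕₚ.m≤n⇒m<n∨m≡n t≤1+p
  ... | inj₁ (s≤s t≤p) = trans (pathExt-≤ z t≤p) (z≗f t≤p)
  ... | inj₂ refl      = trans (pathExt-suc z) (sym f[1+p]≡0)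

  private
    indicator-* : ∀ b z → (if b then 1ℤ else 0ℤ) * z ≡ (if b then z else 0ℤ)
    indicator-* true  z = ℤₚ.*-identityˡ z
    indicator-* false z = ℤₚ.*-zeroˡ z

    if-∨ : ∀ {b c} → ¬ (T b × T c) → ∀ z →
           (if b ∨ c then z else 0ℤ) ≡ (if b then z else 0ℤ) + (if c then z else 0ℤ)
    if-∨ {true}  {true}  b∧c z = ⊥-elim (b∧c _)
    if-∨ {true}  {false} _   z = sym (ℤₚ.+-identityʳ z)
    if-∨ {false} {true}  _   z = sym (ℤₚ.+-identityˡ z)
    if-∨ {false} {false} _   z = refl

    sum-if-cong : ∀ n {b c : Fin n → Bool} (g : Fin n → ℤ) → (∀ k → b k ≡ c k) →
      sumFin n (λ k → if b k then g k else 0ℤ) ≡ sumFin n (λ k → if c k then g k else 0ℤ)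
    sum-if-cong n g b≗c = sumFin-cong n (λ k → cong (λ b → if b then g k else 0ℤ) (b≗c k))

  row : ∀ y v a → toℕ v ≡ a →
    (A · y) v ≡ sumFin (suc p) (λ k → if edgeᵇ a (toℕ k) then y (k ↑ˡ q) else 0ℤ)
              + sumFin q (λ s → if edgeᵇ a (suc (p ℕ.+ toℕ s)) then y (prong s) else 0ℤ)
  row y v a refl = trans (sumFin-++ (suc p) q (λ w → A v w * y w)) (cong₂ _+_
    (sumFin-cong (suc p) (λ k → trans (cong (λ b → (if edgeᵇ (toℕ v) b then 1ℤ else 0ℤ) * y (k ↑ˡ q)) (toℕ-↑ˡ k q))
                                      (indicator-* (edgeᵇ (toℕ v) (toℕ k)) (y (k ↑ˡ q)))))
    (sumFin-cong q (λ s → trans (cong (λ b → (if edgeᵇ (toℕ v) b then 1ℤ else 0ℤ) * y (prong s)) (toℕ-↑ʳ (suc p) s))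
                                (indicator-* (edgeᵇ (toℕ v) (suc (p ℕ.+ toℕ s))) (y (prong s))))))

  centre-row : 1 ≤ p → ∀ y → (A · y) zero ≡ y (pathV 1) + sumFin q (y ∘ prong)
  centre-row 1≤p y = trans (row y zero 0 refl) (cong₂ _+_
    (begin
      sumFin (suc p) (λ k → if edgeᵇ 0 (toℕ k) then y (k ↑ˡ q) else 0ℤ)
        ≡⟨ sum-if-cong (suc p) (λ k → y (k ↑ˡ q)) (λ k → edge-centre-path (toℕ k) (toℕ≤pred[n] k)) ⟩
      sumFin (suc p) (λ k → if toℕ k ≡ᵇ 1 then y (k ↑ˡ q) else 0ℤ)
        ≡⟨ sumFin-indicator p 1 (λ k → y (k ↑ˡ q)) ⟩
      pathExt y 1
        ≡⟨ pathExt-≤ y 1≤p ⟩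
      y (pathV 1) ∎)
    (sum-if-cong q (y ∘ prong) (λ s → edge-centre-prong (toℕ s))))
    where open ≡-Reasoning

  path-row : ∀ j → 1 ≤ j → j ≤ p → ∀ y → (A · y) (pathV j) ≡ pathExt y (suc j) + y (pathV (pred j))
  path-row (suc a) _ a<p y = trans (row y (pathV (suc a)) (suc a) (toℕ-pathV a<p)) (trans (cong₂ _+_
    (begin
      sumFin (suc p) (λ k → if edgeᵇ (suc a) (toℕ k) then y (k ↑ˡ q) else 0ℤ)
        ≡⟨ sum-if-cong (suc p) (λ k → y (k ↑ˡ q)) (λ k → edge-path-path a a<p (toℕ k) (toℕ≤pred[n] k)) ⟩
      sumFin (suc p) (λ k → if (toℕ k ≡ᵇ suc (suc a)) ∨ (toℕ k ≡ᵇ a) then y (k ↑ˡ q) else 0ℤ)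
        ≡⟨ sumFin-cong (suc p) (λ k → if-∨ (neighbours-distinct (toℕ k)) (y (k ↑ˡ q))) ⟩
      sumFin (suc p) (λ k → (if toℕ k ≡ᵇ suc (suc a) then y (k ↑ˡ q) else 0ℤ)
                          + (if toℕ k ≡ᵇ a then y (k ↑ˡ q) else 0ℤ))
        ≡⟨ sumFin-distrib-+ (suc p) (λ k → if toℕ k ≡ᵇ suc (suc a) then y (k ↑ˡ q) else 0ℤ)
                                    (λ k → if toℕ k ≡ᵇ a then y (k ↑ˡ q) else 0ℤ) ⟩
      sumFin (suc p) (λ k → if toℕ k ≡ᵇ suc (suc a) then y (k ↑ˡ q) else 0ℤ)
        + sumFin (suc p) (λ k → if toℕ k ≡ᵇ a then y (k ↑ˡ q) else 0ℤ)
        ≡⟨ cong₂ _+_ (sumFin-indicator p (suc (suc a)) (λ k → y (k ↑ˡ q)))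
                     (trans (sumFin-indicator p a (λ k → y (k ↑ˡ q))) (pathExt-≤ y (ℕₚ.<⇒≤ a<p))) ⟩
      pathExt y (suc (suc a)) + y (pathV a) ∎)
    (trans (sum-if-cong q (y ∘ prong) (λ s → edge-path-prong a a<p (toℕ s))) (sumFin-zero q (λ _ → refl))))
    (ℤₚ.+-identityʳ _))
    where
    open ≡-Reasoning
    neighbours-distinct : ∀ b → ¬ (T (b ≡ᵇ suc (suc a)) × T (b ≡ᵇ a))
    neighbours-distinct b (b≡2+a , b≡a) =
      ℕₚ.<⇒≢ (ℕₚ.m<n⇒m<1+n (ℕₚ.n<1+n a)) (trans (sym (ℕₚ.≡ᵇ⇒≡ b a b≡a)) (ℕₚ.≡ᵇ⇒≡ b _ b≡2+a))

  prong-row : ∀ s y → (A · y) (prong s) ≡ y zero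
  prong-row s y = trans (row y (prong s) (suc (p ℕ.+ toℕ s)) (toℕ-↑ʳ (suc p) s)) (trans (cong₂ _+_
    (trans (sum-if-cong (suc p) (λ k → y (k ↑ˡ q)) (λ k → edge-prong-path (toℕ s) (toℕ k) (toℕ≤pred[n] k)))
           (sumFin-indicator p 0 (λ k → y (k ↑ˡ q))))
    (trans (sum-if-cong q (y ∘ prong) (λ t → edge-prong-prong (toℕ s) (toℕ t))) (sumFin-zero q (λ _ → refl))))
    (ℤₚ.+-identityʳ _))

module BroomConstruction {m : ℕ} (D : Fin m → ℕ) (D≥1 : ∀ i → 1 ≤ D i) where

  open import Data.Integer using (_+_; _-_; _*_; -_)

  P : ℕ
  P = product (tabulate D)

  instance
    P≢0 : ℕ.NonZero P
    P≢0 = product≢0 (All.tabulate⁺ (λ i → ℕ.>-nonZero (D≥1 i)))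

  D∣P : ∀ i → D i ∣ P
  D∣P i = ∈⇒∣product (∈-tabulate⁺ i)

  Q : Fin m → ℕ
  Q i = _∣_.quotient (D∣P i)

  R : Fin m → ℕ
  R i = P ℕ.* Q i

  N : ℕ
  N = P ℕ.* P

  instance
    N≢0 : ℕ.NonZero N
    N≢0 = ℕₚ.m*n≢0 P P

  D*R≡N : ∀ i → D i ℕ.* R i ≡ N
  D*R≡N i = begin
    D i ℕ.* (P ℕ.* Q i)  ≡⟨ ℕₚ.*-comm (D i) _ ⟩
    P ℕ.* Q i ℕ.* D i    ≡⟨ ℕₚ.*-assoc P (Q i) (D i) ⟩
    P ℕ.* (Q i ℕ.* D i)  ≡⟨ cong (P ℕ.*_) (_∣_.equality (D∣P i)) ⟨
    P ℕ.* P              ∎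
    where open ≡-Reasoning

  D∣N : ∀ i → D i ∣ N
  D∣N i = ∣m⇒∣m*n P (D∣P i)

  D∣R : ∀ i j → D i ∣ R j
  D∣R i j = ∣m⇒∣m*n (Q j) (D∣P i)

  R≥1 : ∀ i → 1 ≤ R i
  R≥1 i = ℕ.>-nonZero⁻¹ (R i) {{ℕₚ.m*n≢0 P (Q i) {{P≢0}} {{Q≢0}}}}
    where
    Q≢0 : ℕ.NonZero (Q i)
    Q≢0 = ℕₚ.m*n≢0⇒m≢0 (Q i) {{subst ℕ.NonZero (_∣_.equality (D∣P i)) P≢0}}

  -- K is the sum of r over the prongs: 1 + ∑ R i, with R i = P * Q i.
  K : ℕ
  K = 1 ℕ.+ P ℕ.* sum (tabulate Q)

  y : ℕ
  y = N ℕ.∸ K % N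

  dc : ℕ
  dc = suc (K / N)

  dc*N≡K+y : dc ℕ.* N ≡ K ℕ.+ y
  dc*N≡K+y = suc[m/n]*n≡m+[n∸m%n] K N

  1≤y : 1 ≤ y
  1≤y = ℕₚ.m<n⇒0<n∸m (m%n<n K N)

  y⊥P : Coprime y P
  y⊥P {d} (d∣y , d∣P) = ∣1⇒≡1 (∣m+n∣m⇒∣n (subst (d ∣_) (ℕₚ.+-comm 1 _) d∣K) (∣m⇒∣m*n _ d∣P))
    where
    d∣K : d ∣ K
    d∣K = ∣m+n∣m⇒∣n (subst (d ∣_) (trans dc*N≡K+y (ℕₚ.+-comm K y)) (∣n⇒∣m*n dc (∣m⇒∣m*n P d∣P))) d∣y

  N⊥y : Coprime N y
  N⊥y {d} (d∣N , d∣y) = y⊥P (d∣y , coprime-divisor d⊥P d∣N)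
    where
    d⊥P : Coprime d P
    d⊥P (e∣d , e∣P) = y⊥P (∣-trans e∣d d∣y , e∣P)

  -- opaque, so that unification never unfolds the Euclidean recursion inside p
  opaque
    chain : NegativeContinuedFraction N y
    chain = negativeContinuedFraction N y 1≤y N⊥y

  open NegativeContinuedFraction chain public using () renaming (len to p; 1≤len to 1≤p)
  open NegativeContinuedFraction chain using (x; c; x₀; x₁; x-len; x-suc-len; x-pos; recurrence)
  open Broom p (suc m)

  n : ℕ
  n = suc (p ℕ.+ suc m)

  pathDegree : ℕ → ℕ
  pathDegree zero    = dc
  pathDegree (suc j) = c (suc j)

  prongDegree : Fin (suc m) → ℕ
  prongDegree zero    = N
  prongDegree (suc i) = D i

  prongR : Fin (suc m) → ℕ
  prongR zero    = 1
  prongR (suc i) = R i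

  d : Fin n → ℕ
  d = broomVec pathDegree prongDegree

  r : Fin n → ℕ
  r = broomVec x prongR

  M : Matℤ n
  M = diagMinus d A

  M-centre : ∀ z → (M · z) zero ≡ + dc * z zero - (z (pathV 1) + sumFin (suc m) (z ∘ prong))
  M-centre z = trans (diagMinus-row d A z zero) (cong (_-_ (+ dc * z zero)) (centre-row 1≤p z))

  M-path : ∀ j → 1 ≤ j → j ≤ p → ∀ z →
    (M · z) (pathV j) ≡ + c j * z (pathV j) - (pathExt z (suc j) + z (pathV (pred j)))
  M-path (suc a) 1≤j j≤p z = trans (diagMinus-row d A z (pathV (suc a)))
    (cong₂ (λ k w → + k * z (pathV (suc a)) - w) (lookup-pathV pathDegree prongDegree j≤p) (path-row (suc a) 1≤j j≤p z))

  M-prong : ∀ s z → (M · z) (prong s) ≡ + prongDegree s * z (prong s) - z zero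
  M-prong s z = trans (diagMinus-row d A z (prong s))
    (cong₂ (λ k w → + k * z (prong s) - w) (lookup-prong pathDegree prongDegree s) (prong-row s z))

  M-sym : ∀ u v → M u v ≡ M v u
  M-sym = diagMinus-sym d A A-sym

  rℤ : Vecℤ n
  rℤ v = + r v

  r-pathV : ∀ {j} → j ≤ p → r (pathV j) ≡ x j
  r-pathV = lookup-pathV x prongR

  r-prong : ∀ s → r (prong s) ≡ prongR s
  r-prong = lookup-prong x prongR

  prongDegree*prongR≡N : ∀ s → prongDegree s ℕ.* prongR s ≡ N
  prongDegree*prongR≡N zero    = ℕₚ.*-identityʳ N
  prongDegree*prongR≡N (suc i) = D*R≡N i

  sum-prongR : sumFin (suc m) (rℤ ∘ prong) ≡ + K
  sum-prongR = begin
    sumFin (suc m) (rℤ ∘ prong)              ≡⟨ sumFin-cong (suc m) (cong +_ ∘ r-prong) ⟩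
    1ℤ + sumFin m (λ i → + (P ℕ.* Q i))      ≡⟨ cong (_+_ 1ℤ) (sumFin-cong m (λ i → ℤₚ.pos-* P (Q i))) ⟩
    1ℤ + sumFin m (λ i → + P * + Q i)        ≡⟨ cong (_+_ 1ℤ) (*-distribˡ-sumFin m (+ P) (+_ ∘ Q)) ⟩
    1ℤ + + P * sumFin m (+_ ∘ Q)             ≡⟨ cong (λ s → 1ℤ + + P * s) (sumFin-pos m Q) ⟩
    1ℤ + + P * + sum (tabulate Q)            ≡⟨ cong (_+_ 1ℤ) (ℤₚ.pos-* P _) ⟨
    1ℤ + + (P ℕ.* sum (tabulate Q))          ≡⟨ ℤₚ.pos-+ 1 _ ⟨
    + K                                      ∎
    where open ≡-Reasoning

  centre-balance : + dc * rℤ zero ≡ rℤ (pathV 1) + sumFin (suc m) (rℤ ∘ prong)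
  centre-balance = begin
    + dc * + x 0                                   ≡⟨ cong (λ a → + dc * + a) x₀ ⟩
    + dc * + N                                     ≡⟨ ℤₚ.pos-* dc N ⟨
    + (dc ℕ.* N)                                   ≡⟨ cong +_ (trans dc*N≡K+y (ℕₚ.+-comm K y)) ⟩
    + (y ℕ.+ K)                                    ≡⟨ ℤₚ.pos-+ y K ⟩
    + y + + K                                      ≡⟨ cong₂ _+_ (cong +_ (trans (r-pathV 1≤p) x₁)) sum-prongR ⟨
    rℤ (pathV 1) + sumFin (suc m) (rℤ ∘ prong)     ∎
    where open ≡-Reasoning

  path-balance : ∀ j → 1 ≤ j → j ≤ p → + c j * rℤ (pathV j) ≡ pathExt rℤ (suc j) + rℤ (pathV (pred j))
  path-balance j 1≤j j≤p = begin
    + c j * rℤ (pathV j)                           ≡⟨ cong (λ a → + c j * + a) (r-pathV j≤p) ⟩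
    + c j * + x j                                  ≡⟨ ℤₚ.pos-* (c j) (x j) ⟨
    + (c j ℕ.* x j)                                ≡⟨ cong +_ (trans (recurrence j 1≤j j≤p) (ℕₚ.+-comm (x (pred j)) _)) ⟩
    + (x (suc j) ℕ.+ x (pred j))                   ≡⟨ ℤₚ.pos-+ (x (suc j)) _ ⟩
    + x (suc j) + + x (pred j)
      ≡⟨ cong₂ _+_ (pathExt-≗ rℤ (+_ ∘ x) (cong +_ ∘ r-pathV) (cong +_ x-suc-len) (s≤s j≤p))
                   (cong +_ (r-pathV (ℕₚ.≤-trans ℕₚ.pred[n]≤n j≤p))) ⟨
    pathExt rℤ (suc j) + rℤ (pathV (pred j))       ∎
    where open ≡-Reasoning

  prong-balance : ∀ s → + prongDegree s * rℤ (prong s) ≡ rℤ zero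
  prong-balance s = begin
    + prongDegree s * rℤ (prong s)                 ≡⟨ cong (λ a → + prongDegree s * + a) (r-prong s) ⟩
    + prongDegree s * + prongR s                   ≡⟨ ℤₚ.pos-* (prongDegree s) _ ⟨
    + (prongDegree s ℕ.* prongR s)                 ≡⟨ cong +_ (trans (prongDegree*prongR≡N s) (sym x₀)) ⟩
    rℤ zero                                        ∎
    where open ≡-Reasoning

  r-kernel : ∀ v → (M · rℤ) v ≡ 0ℤ
  r-kernel = broom-ind (λ v → (M · rℤ) v ≡ 0ℤ)
    (trans (M-centre rℤ) (ℤₚ.i≡j⇒i-j≡0 centre-balance))
    (λ j 1≤j j≤p → trans (M-path j 1≤j j≤p rℤ) (ℤₚ.i≡j⇒i-j≡0 (path-balance j 1≤j j≤p)))
    (λ s → trans (M-prong s rℤ) (ℤₚ.i≡j⇒i-j≡0 (prong-balance s)))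

  arithmetical : IsArithmeticalStructure A d r
  arithmetical = record
    { r-pos       = broom-ind (λ v → 0 < r v)
                      (subst (0 <_) (sym x₀) (ℕ.>-nonZero⁻¹ N))
                      (λ j 1≤j j≤p → subst (0 <_) (sym (r-pathV j≤p)) (x-pos j 1≤j j≤p))
                      (λ s → subst (0 <_) (sym (r-prong s)) (prongR≥1 s))
    ; r-primitive = λ k k∣r → ∣1⇒≡1 (subst (k ∣_) (trans (r-pathV ℕₚ.≤-refl) x-len) (k∣r (pathV p)))
    ; kernel      = r-kernel
    }
    where
    prongR≥1 : ∀ s → 1 ≤ prongR s
    prongR≥1 zero    = ℕₚ.≤-refl
    prongR≥1 (suc i) = R≥1 i

  prongPart : Vecℤ m → Fin (suc m) → ℤ
  prongPart u zero    = - sumFin m (λ i → u i * + R i)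
  prongPart u (suc i) = u i

  embed : Vecℤ m → Vecℤ n
  embed u = broomVec (λ _ → 0ℤ) (prongPart u)

  embed-+ : ∀ u u′ → embed (u +ᵥ u′) ≗ embed u +ᵥ embed u′
  embed-+ u u′ v = trans (broomVec-cong (λ _ → refl) prongPart-+ v)
                         (sym (broomVec-zipWith _+_ (λ _ → 0ℤ) (prongPart u) (λ _ → 0ℤ) (prongPart u′) v))
    where
    prongPart-+ : ∀ s → prongPart (u +ᵥ u′) s ≡ prongPart u s + prongPart u′ s
    prongPart-+ zero    = trans (cong -_ (trans (sumFin-cong m (λ i → ℤₚ.*-distribʳ-+ (+ R i) (u i) (u′ i)))
                                                (sumFin-distrib-+ m (λ i → u i * + R i) (λ i → u′ i * + R i))))
                                (ℤₚ.neg-distrib-+ (sumFin m (λ i → u i * + R i)) _)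
    prongPart-+ (suc i) = refl

  embed-neg : ∀ u → embed (λ i → - u i) ≗ λ v → - embed u v
  embed-neg u v = trans (broomVec-cong (λ _ → refl) prongPart-neg v) (sym (broomVec-map -_ (λ _ → 0ℤ) (prongPart u) v))
    where
    prongPart-neg : ∀ s → prongPart (λ i → - u i) s ≡ - prongPart u s
    prongPart-neg zero    = cong -_ (trans (sumFin-cong m (λ i → sym (ℤₚ.neg-distribˡ-* (u i) (+ R i))))
                                           (sumFin-neg m (λ i → u i * + R i)))
    prongPart-neg (suc i) = refl

  embed-* : ∀ k u → embed (λ i → k * u i) ≗ λ v → k * embed u v
  embed-* k u v = trans (broomVec-cong (λ _ → sym (ℤₚ.*-zeroʳ k)) prongPart-* v)
                        (sym (broomVec-map (k *_) (λ _ → 0ℤ) (prongPart u) v))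
    where
    prongPart-* : ∀ s → prongPart (λ i → k * u i) s ≡ k * prongPart u s
    prongPart-* zero    = begin
      - sumFin m (λ i → k * u i * + R i)   ≡⟨ cong -_ (sumFin-cong m (λ i → ℤₚ.*-assoc k (u i) (+ R i))) ⟩
      - sumFin m (λ i → k * (u i * + R i)) ≡⟨ cong -_ (*-distribˡ-sumFin m k (λ i → u i * + R i)) ⟩
      - (k * sumFin m (λ i → u i * + R i)) ≡⟨ ℤₚ.neg-distribʳ-* k _ ⟩
      k * - sumFin m (λ i → u i * + R i)   ∎
      where open ≡-Reasoning
    prongPart-* (suc i) = refl

  -- For u = D q the preimage is q on the prongs i + 1, balanced by − ∑ q on prong 0.
  divisible⇒image : ∀ u → DivisibleBy D u → InImage M (embed u)
  divisible⇒image u D∣u = z , broom-ind (λ v → embed u v ≡ (M · z) v) centre path prongs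
    where
    q : Vecℤ m
    q i = DS._∣_.quotient (DS.∣ᵤ⇒∣ {+ D i} {u i} (D∣u i))

    u≡q*D : ∀ i → u i ≡ q i * + D i
    u≡q*D i = DS._∣_.equality (DS.∣ᵤ⇒∣ {+ D i} {u i} (D∣u i))

    prongZ : Fin (suc m) → ℤ
    prongZ zero    = - sumFin m q
    prongZ (suc i) = q i

    z : Vecℤ n
    z = broomVec (λ _ → 0ℤ) prongZ

    *0-0 : ∀ a → a * 0ℤ - (0ℤ + 0ℤ) ≡ 0ℤ
    *0-0 = solve-∀

    sum-prongZ : sumFin (suc m) (z ∘ prong) ≡ 0ℤ
    sum-prongZ = trans (sumFin-cong (suc m) (lookup-prong _ _)) (ℤₚ.+-inverseˡ (sumFin m q))

    centre : 0ℤ ≡ (M · z) zero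
    centre = sym (trans (M-centre z) (trans (cong (λ t → + dc * 0ℤ - t) (cong₂ _+_ (lookup-pathV _ _ 1≤p) sum-prongZ))
                                            (*0-0 (+ dc))))

    path : ∀ j → 1 ≤ j → j ≤ p → embed u (pathV j) ≡ (M · z) (pathV j)
    path j 1≤j j≤p = trans (lookup-pathV _ _ j≤p) (sym (trans (M-path j 1≤j j≤p z)
      (trans (cong₂ (λ a t → + c j * a - t) (lookup-pathV _ _ j≤p)
                    (cong₂ _+_ (pathExt-≗ z (λ _ → 0ℤ) (lookup-pathV _ _) refl (s≤s j≤p))
                               (lookup-pathV _ _ (ℕₚ.≤-trans ℕₚ.pred[n]≤n j≤p))))
             (*0-0 (+ c j)))))

    prong-value : ∀ s → + prongDegree s * prongZ s - 0ℤ ≡ prongPart u s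
    prong-value zero    = begin
      + N * - sumFin m q - 0ℤ               ≡⟨ ℤₚ.+-identityʳ (+ N * - sumFin m q) ⟩
      + N * - sumFin m q                    ≡⟨ ℤₚ.neg-distribʳ-* (+ N) _ ⟨
      - (+ N * sumFin m q)                  ≡⟨ cong -_ (*-distribˡ-sumFin m (+ N) q) ⟨
      - sumFin m (λ i → + N * q i)          ≡⟨ cong -_ (sumFin-cong m (λ i → sym (qDR≡Nq i))) ⟩
      - sumFin m (λ i → u i * + R i)        ∎
      where
      open ≡-Reasoning
      qDR≡Nq : ∀ i → u i * + R i ≡ + N * q i
      qDR≡Nq i = begin
        u i * + R i              ≡⟨ cong (_* + R i) (u≡q*D i) ⟩
        q i * + D i * + R i      ≡⟨ ℤₚ.*-assoc (q i) _ _ ⟩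
        q i * (+ D i * + R i)    ≡⟨ cong (q i *_) (trans (sym (ℤₚ.pos-* (D i) (R i))) (cong +_ (D*R≡N i))) ⟩
        q i * + N                ≡⟨ ℤₚ.*-comm (q i) (+ N) ⟩
        + N * q i                ∎
    prong-value (suc i) = trans (ℤₚ.+-identityʳ (+ D i * q i)) (trans (ℤₚ.*-comm (+ D i) (q i)) (sym (u≡q*D i)))

    prongs : ∀ s → embed u (prong s) ≡ (M · z) (prong s)
    prongs s = trans (lookup-prong _ _ s) (sym (trans (M-prong s z)
      (trans (cong (λ a → + prongDegree s * a - 0ℤ) (lookup-prong _ _ s)) (prong-value s))))

  image⇒divisible : ∀ u → InImage M (embed u) → DivisibleBy D u
  image⇒divisible u (z , u≡Mz) i = DS.∣⇒∣ᵤ {+ D i} {u i} (subst (+ D i DS.∣_) (sym u-form)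
    (DS.∣m∣n⇒∣m-n (DS.∣m⇒∣m*n (z (prong (suc i))) DS.∣-refl)
                  (DS.∣m∣n⇒∣m+n (DS.∣m⇒∣m*n (z (prong zero)) (DS.∣ᵤ⇒∣ {+ D i} {+ N} (D∣N i)))
                                (sumFin-divisible m (λ j → u j * + R j)
                                  (λ j → DS.∣n⇒∣m*n (u j) (DS.∣ᵤ⇒∣ {+ D i} {+ R j} (D∣R i j)))))))
    where
    S : ℤ
    S = sumFin m (λ j → u j * + R j)
    at : ∀ s → prongPart u s ≡ + prongDegree s * z (prong s) - z zero
    at s = trans (sym (lookup-prong _ _ s)) (trans (u≡Mz (prong s)) (M-prong s z))
    u-form : u i ≡ + D i * z (prong (suc i)) - (+ N * z (prong zero) + S)
    u-form = eliminate {b = + D i * z (prong (suc i))} {+ N * z (prong zero)} {S} {z zero} (at (suc i)) (at zero)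
      where
      eliminate : ∀ {a b c s w} → a ≡ b - w → - s ≡ c - w → a ≡ b - (c + s)
      eliminate {b = b} {c} {s} {w} a≡b-w -s≡c-w =
        trans a≡b-w (cong (_-_ b) (trans (double-sub c w) (trans (cong (_-_ c) (sym -s≡c-w)) (sub-neg c s))))
        where
        double-sub : ∀ c w → w ≡ c - (c - w)
        double-sub = solve-∀
        sub-neg : ∀ c s → c - - s ≡ c + s
        sub-neg = solve-∀

  embed-torsion : ∀ u → IsTorsion M (embed u)
  embed-torsion u = P , ℕ.>-nonZero⁻¹ P , InImage-resp M (embed-* (+ P) u)
    (divisible⇒image (λ i → + P * u i)
                     (λ i → DS.∣⇒∣ᵤ {+ D i} {+ P * u i} (DS.∣m⇒∣m*n (u i) (DS.∣ᵤ⇒∣ {+ D i} {+ P} (D∣P i)))))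

  -- Back substitution along the path clears w − M z off the centre and the path;
  -- orthogonality to r then fixes its entry on prong 0.
  module Reduction (w : Vecℤ n) where

    solution : ∃ λ Y → Y (suc p) ≡ 0ℤ ×
      (∀ j → 1 ≤ j → j ≤ p → + c j * Y j - (Y (suc j) + Y (pred j)) ≡ w (pathV j))
    solution = backSubstitution p (λ j → + c j) (λ j → w (pathV j))

    Y : ℕ → ℤ
    Y = proj₁ solution

    Y[1+p]≡0 : Y (suc p) ≡ 0ℤ
    Y[1+p]≡0 = proj₁ (proj₂ solution)

    Y-solves : ∀ j → 1 ≤ j → j ≤ p → + c j * Y j - (Y (suc j) + Y (pred j)) ≡ w (pathV j)
    Y-solves = proj₂ (proj₂ solution)

    prongZ : Fin (suc m) → ℤ
    prongZ zero    = + dc * Y 0 - Y 1 - w zero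
    prongZ (suc i) = 0ℤ

    z : Vecℤ n
    z = broomVec Y prongZ

    e : Vecℤ n
    e = w -ᵥ (M · z)

    b : Vecℤ m
    b i = w (prong (suc i)) + Y 0

    E₀ : ℤ
    E₀ = w (prong zero) - (+ N * prongZ zero - Y 0)

    e-path : ∀ k → e (k ↑ˡ suc m) ≡ 0ℤ
    e-path = path-ind (λ v → e v ≡ 0ℤ)
      (ℤₚ.i≡j⇒i-j≡0 (sym (begin
        (M · z) zero                                          ≡⟨ M-centre z ⟩
        + dc * Y 0 - (z (pathV 1) + sumFin (suc m) (z ∘ prong)) ≡⟨ cong (λ t → + dc * Y 0 - t)
                                                                     (cong₂ _+_ (lookup-pathV Y prongZ 1≤p) sum-prongZ) ⟩
        + dc * Y 0 - (Y 1 + (+ dc * Y 0 - Y 1 - w zero))      ≡⟨ cancel (+ dc * Y 0) (Y 1) (w zero) ⟩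
        w zero                                                ∎)))
      (λ j 1≤j j≤p → ℤₚ.i≡j⇒i-j≡0 (sym (begin
        (M · z) (pathV j)                                     ≡⟨ M-path j 1≤j j≤p z ⟩
        + c j * z (pathV j) - (pathExt z (suc j) + z (pathV (pred j)))
          ≡⟨ cong₂ (λ a t → + c j * a - t) (lookup-pathV Y prongZ j≤p)
                   (cong₂ _+_ (pathExt-≗ z Y (lookup-pathV Y prongZ) Y[1+p]≡0 (s≤s j≤p))
                              (lookup-pathV Y prongZ (ℕₚ.≤-trans ℕₚ.pred[n]≤n j≤p))) ⟩
        + c j * Y j - (Y (suc j) + Y (pred j))                ≡⟨ Y-solves j 1≤j j≤p ⟩
        w (pathV j)                                           ∎)))
      where
      open ≡-Reasoning
      sum-prongZ : sumFin (suc m) (z ∘ prong) ≡ prongZ zero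
      sum-prongZ = trans (sumFin-cong (suc m) (lookup-prong Y prongZ))
                         (trans (cong (_+_ (prongZ zero)) (sumFin-zero m (λ _ → refl))) (ℤₚ.+-identityʳ _))
      cancel : ∀ a y₁ w₀ → a - (y₁ + (a - y₁ - w₀)) ≡ w₀
      cancel = solve-∀

    e-prong : ∀ s → e (prong s) ≡ w (prong s) - (+ prongDegree s * prongZ s - Y 0)
    e-prong s = cong (_-_ (w (prong s))) (trans (M-prong s z)
                  (cong₂ (λ a t → + prongDegree s * a - t) (lookup-prong Y prongZ s) (lookup-pathV Y prongZ z≤n)))

    e-prong-suc : ∀ i → e (prong (suc i)) ≡ b i
    e-prong-suc i = trans (e-prong (suc i)) (sub-*0 (w (prong (suc i))) (+ D i) (Y 0))
      where
      sub-*0 : ∀ a k y → a - (k * 0ℤ - y) ≡ a + y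
      sub-*0 = solve-∀

    dot-r-e : dot rℤ e ≡ E₀ + sumFin m (λ i → + R i * b i)
    dot-r-e = begin
      dot rℤ e
        ≡⟨ sumFin-++ (suc p) (suc m) (λ v → rℤ v * e v) ⟩
      sumFin (suc p) (λ k → rℤ (k ↑ˡ suc m) * e (k ↑ˡ suc m)) + sumFin (suc m) (λ s → rℤ (prong s) * e (prong s))
        ≡⟨ cong₂ _+_ (sumFin-zero (suc p) (λ k → trans (cong (rℤ (k ↑ˡ suc m) *_) (e-path k))
                                                       (ℤₚ.*-zeroʳ (rℤ (k ↑ˡ suc m)))))
                     (sumFin-cong (suc m) (λ s → cong (_* e (prong s)) (cong +_ (r-prong s)))) ⟩
      0ℤ + (1ℤ * e (prong zero) + sumFin m (λ i → + R i * e (prong (suc i))))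
        ≡⟨ cong₂ (λ a t → 0ℤ + (1ℤ * a + t)) (e-prong zero) (sumFin-cong m (λ i → cong (+ R i *_) (e-prong-suc i))) ⟩
      0ℤ + (1ℤ * E₀ + sumFin m (λ i → + R i * b i))
        ≡⟨ trans (ℤₚ.+-identityˡ _) (cong (_+ sumFin m (λ i → + R i * b i)) (ℤₚ.*-identityˡ E₀)) ⟩
      E₀ + sumFin m (λ i → + R i * b i) ∎
      where open ≡-Reasoning

    module _ (w-torsion : IsTorsion M w) where

      dot-r-e≡0 : dot rℤ e ≡ 0ℤ
      dot-r-e≡0 = trans (dot-distrib-- rℤ w (M · z))
        (cong₂ _-_ (torsion⊥kernel M M-sym rℤ r-kernel w-torsion) (kernel⊥image M M-sym rℤ r-kernel z))

      E₀≡ : E₀ ≡ - sumFin m (λ i → b i * + R i)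
      E₀≡ = trans (solve-for E₀ _ (trans (sym dot-r-e) dot-r-e≡0))
                  (cong -_ (sumFin-cong m (λ i → ℤₚ.*-comm (+ R i) (b i))))
        where
        solve-for : ∀ a s → a + s ≡ 0ℤ → a ≡ - s
        solve-for a s a+s≡0 = trans (add-sub a s) (trans (cong (_- s) a+s≡0) (ℤₚ.+-identityˡ (- s)))
          where
          add-sub : ∀ a s → a ≡ a + s - s
          add-sub = solve-∀

      e≗embed-b : e ≗ embed b
      e≗embed-b = broom-ind (λ v → e v ≡ embed b v)
        (e-path zero)
        (λ j _ j≤p → trans (e-path (clamp p j)) (sym (lookup-pathV (λ _ → 0ℤ) (prongPart b) j≤p)))
        (λ s → trans (e-prong-prongPart s) (sym (lookup-prong (λ _ → 0ℤ) (prongPart b) s)))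
        where
        e-prong-prongPart : ∀ s → e (prong s) ≡ prongPart b s
        e-prong-prongPart zero    = trans (e-prong zero) E₀≡
        e-prong-prongPart (suc i) = e-prong-suc i

      Mz≗w-embed-b : M · z ≗ w -ᵥ embed b
      Mz≗w-embed-b v = trans (sub-sub (w v) ((M · z) v)) (cong (_-_ (w v)) (e≗embed-b v))
        where
        sub-sub : ∀ a t → t ≡ a - (a - t)
        sub-sub = solve-∀

  torsion⇒embed : ∀ w → IsTorsion M w → ∃ λ u → InImage M (w -ᵥ embed u)
  torsion⇒embed w w-torsion = b , InImage-resp M (Mz≗w-embed-b w-torsion) (InImage-self M z)
    where open Reduction w

  presentation : DiagonalPresentation M D
  presentation = record
    { embed           = embed
    ; embed-+         = embed-+
    ; embed-neg       = embed-neg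
    ; embed-torsion   = embed-torsion
    ; divisible⇒image = divisible⇒image
    ; image⇒divisible = image⇒divisible
    ; torsion⇒embed   = torsion⇒embed
    }

open import Data.Nat using (_+_)

proposition7p1 : ∀ {c ℓ} (m : ℕ) → 1 ≤ m → (G : AbelianGroup c ℓ) → Finite G → HasAtMostInvariantFactors m G →
    Σ ℕ λ p → (1 ≤ p) × Σ (Fin (suc (p + suc m)) → ℕ) λ d → Σ (Fin (suc (p + suc m)) → ℕ) λ r →
      IsArithmeticalStructure (broomAdj p (suc m)) d r × IsoToCriticalGroup G (broomAdj p (suc m)) d
proposition7p1 m _ G _ (k , k≤m , a , 1<a , _ , G≅⊕ℤ/a) with ℕₚ.m≤n⇒∃[o]m+o≡n k≤m
... | l , refl = p , 1≤p , d , r , arithmetical ,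
                 DiagonalPresentation⇒IsoToSubquotient (IsoToSubquotient-pad l G≅⊕ℤ/a) presentation
  where
  a++1≥1 : ∀ i → 1 ≤ (a ++ λ _ → 1) i
  a++1≥1 = ↑-ind k l _ (λ i → subst (1 ≤_) (sym (lookup-++ˡ a _ i)) (ℕₚ.<⇒≤ (1<a i)))
                       (λ j → subst (1 ≤_) (sym (lookup-++ʳ a _ j)) ℕₚ.≤-refl)
  open BroomConstruction (a ++ λ _ → 1) a++1≥1 using (p; 1≤p; d; r; arithmetical; presentation)
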